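{- Let $\Gamma=(G,F)$ be a framed graph and let $\Delta\lessdot\Delta'$ be a covering relation in the framing lattice $\mathcal L_\Gamma$ (or, more generally, let $\Delta,\Delta'$ be adjacent maximal cliques). Let $r\in\Delta\setminus\Delta'$ and $r'\in\Delta'\setminus\Delta$, let $s$ be their unique subroute of conflict, and write $r=r_1\,s\,r_2$ and $r'=r'_1\,s\,r'_2$. Then the last edges of $r_1$ and of $r'_1$ are two incoming edges of the first vertex of $s$ which are consecutive in the framing order on incoming edges at that vertex, so they define a left corner $c_1$; and the first edges of $r_2$ and of $r'_2$ are two outgoing edges of the last vertex of $s$ which are consecutive in the framing order on outgoing edges at that vertex, so they define a right corner $c_2$.
   Context: A flow graph $G$ is a finite directed acyclic graph with vertex set $[n]$ and a finite multiset of edges, each directed from a smaller to a larger vertex. A source (resp. sink) is a vertex with no incoming (resp. outgoing) edge; the other vertices are internal. A route is a directed path from a source to a sink. A framing $F$ of $G$ is a choice, at every internal vertex $v$, of a total order $<_{\mathrm{in}(v)}$ on the incoming edges of $v$ and a total order $<_{\mathrm{out}(v)}$ on the outgoing edges of $v$; $\Gamma=(G,F)$ is a framed graph. For routes $p,q$ through an internal vertex $v$, the outgoing preorder $\le^+_v$ compares their suffixes starting at $v$ lexicographically as words of edges, comparing outgoing edges at each vertex via $<_{\mathrm{out}}$; the incoming preorder $\le^-_v$ compares their prefixes ending at $v$, read backwards from $v$, lexicographically via the orders $<_{\mathrm{in}}$. The route $p$ is clockwise to $q$ at $v$ if $p<^-_v q$ and $p>^+_v q$. Two routes are coherent if neither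 is clockwise to the other at any internal vertex they share; if they are not coherent at $v$, their maximal common subpath containing $v$ is a subroute of conflict. A maximal clique is an inclusion-maximal set of pairwise coherent routes. Two maximal cliques $\Delta,\Delta'$ are adjacent if $|\Delta\setminus\Delta'|=|\Delta'\setminus\Delta|=1$; it is known that then the two routes $r\in\Delta\setminus\Delta'$, $r'\in\Delta'\setminus\Delta$ have a unique subroute of conflict. The framing lattice $\mathcal L_\Gamma$ is the lattice on maximal cliques whose cover relations are $\Delta\lessdot\Delta'$ for adjacent $\Delta,\Delta'$ such that $r$ is clockwise to $r'$ at their subroute of conflict. A left corner is a triple $c=(c^\bullet,c^\downarrow,c^\uparrow)$ where $c^\bullet$ is an internal vertex and $c^\downarrow<_{\mathrm{in}(c^\bullet)}c^\uparrow$ are two incoming edges of $c^\bullet$ that are consecutive in this order; a right corner is defined in the same way with two consecutive outgoing edges $c^\downarrow<_{\mathrm{out}(c^\bullet)}c^\uparrow$. -}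

module Defs where

open import Level using (0ℓ)
open import Data.Nat using (ℕ)
open import Data.Fin using (Fin) renaming (_<_ to _<ᶠ_)
open import Data.List using (List; []; _∷_; _++_; reverse)
open import Data.List.Relation.Unary.Any using (Any)
open import Data.List.Relation.Binary.Lex.Core using (Lex-≤)
open import Data.Product using (Σ; ∃; ∃-syntax; _×_; _,_; proj₁; proj₂)
open import Data.Sum using (_⊎_)
open import Relation.Nullary using (¬_)
open import Relation.Binary.PropositionalEquality using (_≡_; _≢_)
open import Relation.Unary using (Pred; _∈_; _∉_; _⊆_)

-- A flow graph: vertex set [n] (as Fin n), a finite multiset of edges
-- (indexed by Fin m, so parallel edges are allowed), each directed
-- from a smaller to a larger vertex.
record FlowGraph : Set where
  field
    n m : ℕ
    src tgt : Fin m → Fin n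
    src<tgt : ∀ e → src e <ᶠ tgt e

  Vertex : Set
  Vertex = Fin n

  Edge : Set
  Edge = Fin m

  Source : Vertex → Set
  Source v = ¬ (∃[ e ] tgt e ≡ v)

  Sink : Vertex → Set
  Sink v = ¬ (∃[ e ] src e ≡ v)

  Internal : Vertex → Set
  Internal v = ¬ Source v × ¬ Sink v

-- The relation _<in_ is the disjoint union of the
-- orders <_in(v) over internal v (it only relates edges with a common
-- internal target); likewise _<out_.
record Framing (G : FlowGraph) : Set₁ where
  open FlowGraph G
  field
    _<in_  : Edge → Edge → Set
    _<out_ : Edge → Edge → Set
    in-tgt      : ∀ {e e'} → e <in e' → tgt e ≡ tgt e'
    in-internal : ∀ {e e'} → e <in e' → Internal (tgt e)
    in-irrefl   : ∀ e → ¬ (e <in e)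
    in-trans    : ∀ {e e' e''} → e <in e' → e' <in e'' → e <in e''
    in-total    : ∀ e e' → tgt e ≡ tgt e' → Internal (tgt e) → e ≢ e' →
                  (e <in e') ⊎ (e' <in e)
    out-src      : ∀ {e e'} → e <out e' → src e ≡ src e'
    out-internal : ∀ {e e'} → e <out e' → Internal (src e)
    out-irrefl   : ∀ e → ¬ (e <out e)
    out-trans    : ∀ {e e' e''} → e <out e' → e' <out e'' → e <out e''
    out-total    : ∀ e e' → src e ≡ src e' → Internal (src e) → e ≢ e' →
                   (e <out e') ⊎ (e' <out e)

module Framed (G : FlowGraph) (F : Framing G) where
  open FlowGraph G public
  open Framing F public

  Walk : Set
  Walk = Vertex × List Edge

  data Chain : Vertex → List Edge → Vertex → Set where
    []  : ∀ {v} → Chain v [] v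
    _∷_ : ∀ {v w e es} → src e ≡ v → Chain (tgt e) es w → Chain v (e ∷ es) w

  lastV : Vertex → List Edge → Vertex
  lastV x []       = x
  lastV x (e ∷ es) = lastV (tgt e) es

  IsRoute : Walk → Set
  IsRoute (u , es) = Source u × ∃[ w ] (Chain u es w × Sink w)

  Through : Walk → Vertex → List Edge → List Edge → Set
  Through p v p₁ p₂ = proj₂ p ≡ p₁ ++ p₂ × Chain (proj₁ p) p₁ v

  InLeq : List Edge → List Edge → Set
  InLeq p₁ q₁ = Lex-≤ _≡_ _<in_ (reverse p₁) (reverse q₁)

  OutLeq : List Edge → List Edge → Set
  OutLeq p₂ q₂ = Lex-≤ _≡_ _<out_ p₂ q₂

  InLt : List Edge → List Edge → Set
  InLt a b = InLeq a b × ¬ InLeq b a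

  OutLt : List Edge → List Edge → Set
  OutLt a b = OutLeq a b × ¬ OutLeq b a

  Clockwise : Walk → Walk → Vertex → Set
  Clockwise p q v =
    Internal v ×
    ∃[ p₁ ] ∃[ p₂ ] ∃[ q₁ ] ∃[ q₂ ]
      (Through p v p₁ p₂ × Through q v q₁ q₂ × InLt p₁ q₁ × OutLt q₂ p₂)

  Coherent : Walk → Walk → Set
  Coherent p q = ∀ v → ¬ Clockwise p q v × ¬ Clockwise q p v

  IsClique : Pred Walk 0ℓ → Set
  IsClique Δ = (∀ {p} → p ∈ Δ → IsRoute p) ×
               (∀ {p q} → p ∈ Δ → q ∈ Δ → Coherent p q)

  MaximalClique : Pred Walk 0ℓ → Set₁
  MaximalClique Δ = IsClique Δ × (∀ (Θ : Pred Walk 0ℓ) → IsClique Θ → Δ ⊆ Θ → Θ ⊆ Δ)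

  OnlyDiff : Pred Walk 0ℓ → Pred Walk 0ℓ → Walk → Set
  OnlyDiff Δ Δ' r = r ∈ Δ × r ∉ Δ' × (∀ {x} → x ∈ Δ → x ∉ Δ' → x ≡ r)

  Adjacent : Pred Walk 0ℓ → Pred Walk 0ℓ → Set
  Adjacent Δ Δ' = (∃[ r ] OnlyDiff Δ Δ' r) × (∃[ r' ] OnlyDiff Δ' Δ r')

  Splits : Walk → List Edge → Walk → List Edge → Set
  Splits p a s b = proj₂ p ≡ a ++ (proj₂ s ++ b) × Chain (proj₁ p) a (proj₁ s)

  SubpathOf : Walk → Walk → Set
  SubpathOf s p = ∃[ a ] ∃[ b ] Splits p a s b

  OnWalk : Vertex → Walk → Set
  OnWalk v s = v ≡ proj₁ s ⊎ Any (λ e → tgt e ≡ v) (proj₂ s)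

  CommonContaining : Walk → Walk → Vertex → Walk → Set
  CommonContaining p q v s = SubpathOf s p × SubpathOf s q × OnWalk v s

  MaxCommon : Walk → Walk → Vertex → Walk → Set
  MaxCommon p q v s = CommonContaining p q v s ×
    (∀ t → CommonContaining p q v t → SubpathOf s t → t ≡ s)

  SubrouteOfConflict : Walk → Walk → Walk → Set
  SubrouteOfConflict p q s =
    ∃[ v ] ((Clockwise p q v ⊎ Clockwise q p v) × MaxCommon p q v s)

  IsLeftCorner : Vertex → Edge → Edge → Set
  IsLeftCorner v lo hi = Internal v × tgt lo ≡ v × tgt hi ≡ v × lo <in hi ×
    ¬ (∃[ f ] (tgt f ≡ v × lo <in f × f <in hi))

  IsRightCorner : Vertex → Edge → Edge → Set
  IsRightCorner v lo hi = Internal v × src lo ≡ v × src hi ≡ v × lo <out hi ×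
    ¬ (∃[ f ] (src f ≡ v × lo <out f × f <out hi))

-- Say r is clockwise to r′ at a vertex of the subroute of conflict s.  Cancelling s gives r₁ <⁻ r′₁ and
-- r′₂ <⁺ r₂, and maximality of s forces r₁, r′₁ to differ already in their last edges e <in e′, and r₂, r′₂
-- in their first edges f′ <out f.  Suppose an incoming edge g of s₀ satisfies e <in g <in e′.  Then no
-- route of Δ uses g: r enters s₀ along e, and any other route z of Δ lies in Δ′, where coherence of z
-- with r and with r′ would give  s r₂ ≤⁺ (z after g) ≤⁺ s r′₂,  contradicting  s r′₂ <⁺ s r₂.  But every
-- edge lies on a route of a maximal clique: otherwise one builds, greedily backwards and forwards from
-- the edge, a route through it that is coherent with the whole clique, and maximality puts it into the
-- clique.  The outgoing edges at the end of s are handled symmetrically.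

module Submission where

open import Defs
open import Level using (0ℓ)
open import Data.Nat using (ℕ; zero; suc; _+_; _≤_; s≤s)
open import Data.Nat.Properties using (≤-reflexive; ≤-trans; <⇒≤; +-suc; +-monoˡ-≤; +-identityʳ; m+n≤o⇒n≤o; m+1+n≰m)
open import Data.Fin using (Fin; toℕ; _≟_) renaming (_<_ to _<ᶠ_; _>_ to _>ᶠ_)
open import Data.Fin.Induction using (<-wellFounded; >-wellFounded)
open import Induction.WellFounded using (Acc; acc)
open import Data.Fin.Properties using (toℕ<n)
open import Data.List using (List; []; _∷_; _++_; _∷ʳ_; reverse; length; map; concatMap; allFin)
open import Data.List.Properties
  using (++-assoc; ++-identityʳ; ++-identityˡ-unique; ++-identityʳ-unique; ++-cancelˡ; ∷-injective; ∷-injectiveˡ; ∷-injectiveʳ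
        ; ∷ʳ-injectiveʳ; reverse-++; unfold-reverse; reverse-involutive)
open import Data.List.Membership.Propositional using () renaming (_∈_ to _∈ₗ_; _∉_ to _∉ₗ_)
open import Data.List.Membership.Propositional.Properties using (∈-∃++; ∈-++⁺ˡ; ∈-++⁺ʳ; ∈-map⁺; ∈-concatMap⁺; ∈-allFin)
open import Data.List.Relation.Unary.Any as Any using (Any; here; there)
open import Data.List.Relation.Unary.Any.Properties using (++⁺ˡ; ++⁺ʳ)
open import Data.List.Relation.Binary.Lex.Core using (Lex-≤; base; halt; this; next)
open import Data.List.Relation.Binary.Lex.Strict using (≤-transitive)
open import Data.Product as Product using (∃; ∃-syntax; ∃₂; _×_; _,_; proj₁; proj₂)
open import Data.Empty using (⊥)
open import Data.Sum as Sum using (_⊎_; inj₁; inj₂; [_,_]′)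
open import Data.Unit using (tt)
open import Effect.Monad using (RawMonad)
open import Relation.Binary.Core using (Rel)
open import Relation.Binary.Definitions using (Transitive; DecidableEquality)
open import Relation.Binary.Construct.Flip.EqAndOrd as Flip using ()
open import Relation.Binary.Structures using (IsStrictPartialOrder)
open import Relation.Binary.PropositionalEquality using (_≡_; _≢_; refl; sym; trans; cong; subst; subst₂; isEquivalence; resp₂)
open import Relation.Nullary using (¬_; yes; no; contradiction)
open import Relation.Nullary.Decidable using (¬¬-excluded-middle)
open import Relation.Nullary.Negation using (¬¬-Monad)
open import Relation.Unary using (Pred; _∈_; _∉_)

-- Membership in a clique is undecidable, so extremal routes are chosen under double negation;
-- every conclusion drawn from such choices is a negation.
open RawMonad (¬¬-Monad {0ℓ}) using (_>>=_; pure)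

¬¬⊥⇒⊥ : ¬ ¬ ⊥ → ⊥
¬¬⊥⇒⊥ ¬¬⊥ = ¬¬⊥ (λ ())

module _ {X : Set} {_<_ : Rel X 0ℓ} (<-isStrictPartialOrder : IsStrictPartialOrder _≡_ _<_) where
  open IsStrictPartialOrder <-isStrictPartialOrder using (irrefl) renaming (trans to <-trans)

  ¬¬-maximal : (P : X → Set) (xs : List X) {a : X} → P a →
    ¬ ¬ (∃ λ b → P b × ∀ {c} → c ∈ₗ xs → P c → ¬ b < c)
  ¬¬-maximal P []       pa = pure (_ , pa , λ ())
  ¬¬-maximal P (x ∷ xs) pa = do
    b , pb , b-max ← ¬¬-maximal P xs pa
    yes (px , b<x) ← ¬¬-excluded-middle {A = P x × b < x}
      where no ¬px×b<x → pure (b , pb , λ { (here refl) pc b<c → ¬px×b<x (pc , b<c)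
                                          ; (there c∈xs) → b-max c∈xs })
    pure (x , px , λ { (here refl) _ x<x → irrefl refl x<x
                     ; (there c∈xs) pc x<c → b-max c∈xs pc (<-trans b<x x<c) })

-- A chain has at most n edges, so maxima over prefixes or suffixes of routes range over lists≤ n.
lists≤ : ∀ {m} → ℕ → List (List (Fin m))
lists≤ zero    = [] ∷ []
lists≤ (suc ℓ) = [] ∷ concatMap (λ x → map (x ∷_) (lists≤ ℓ)) (allFin _)

∈-lists≤ : ∀ {m} ℓ (xs : List (Fin m)) → length xs ≤ ℓ → xs ∈ₗ lists≤ ℓ
∈-lists≤ zero    []       _         = here refl
∈-lists≤ (suc ℓ) []       _         = here refl
∈-lists≤ (suc ℓ) (x ∷ xs) (s≤s len) =
  there (∈-concatMap⁺ _ (Any.map (λ { refl → ∈-map⁺ (x ∷_) (∈-lists≤ ℓ xs len) }) (∈-allFin x)))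

module _ {A : Set} where

  ++-∷≢[] : ∀ (as : List A) {x bs} → as ++ x ∷ bs ≢ []
  ++-∷≢[] []      ()
  ++-∷≢[] (_ ∷ _) ()

  ++-reassoc : ∀ as cs {xs bs ds : List A} → xs ≡ as ++ bs → bs ≡ cs ++ ds → xs ≡ (as ++ cs) ++ ds
  ++-reassoc as cs {ds = ds} refl refl = sym (++-assoc as cs ds)

  ++-∷≡∷ʳ : ∀ (as : List A) {x bs cs y} → as ++ x ∷ bs ≡ cs ∷ʳ y →
    (as ≡ cs × x ≡ y) ⊎ ∃ λ ds → cs ≡ as ++ x ∷ ds
  ++-∷≡∷ʳ []       {cs = []}     refl = inj₁ (refl , refl)
  ++-∷≡∷ʳ []       {cs = c ∷ cs} refl = inj₂ (cs , refl)
  ++-∷≡∷ʳ (a ∷ as) {cs = []}     eq   = contradiction (∷-injectiveʳ eq) (++-∷≢[] as)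
  ++-∷≡∷ʳ (a ∷ as) {cs = c ∷ cs} eq   with refl , eq′ ← ∷-injective eq with ++-∷≡∷ʳ as eq′
  ... | inj₁ (refl , refl) = inj₁ (refl , refl)
  ... | inj₂ (ds , refl)   = inj₂ (ds , refl)

  ++-∷≡++ : ∀ (as cs : List A) {x bs ds} → as ++ x ∷ bs ≡ cs ++ ds →
    (∃ λ as₂ → as ≡ cs ++ as₂ × ds ≡ as₂ ++ x ∷ bs) ⊎ (∃ λ bs₁ → cs ≡ as ++ x ∷ bs₁ × bs ≡ bs₁ ++ ds)
  ++-∷≡++ []       []       refl = inj₁ ([] , refl , refl)
  ++-∷≡++ []       (c ∷ cs) refl = inj₂ (cs , refl , refl)
  ++-∷≡++ (a ∷ as) []       refl = inj₁ (a ∷ as , refl , refl)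
  ++-∷≡++ (a ∷ as) (c ∷ cs) eq   with refl , eq′ ← ∷-injective eq with ++-∷≡++ as cs eq′
  ... | inj₁ (as₂ , refl , refl) = inj₁ (as₂ , refl , refl)
  ... | inj₂ (bs₁ , refl , refl) = inj₂ (bs₁ , refl , refl)

  ∈⊎prefix : ∀ (as cs : List A) {x y bs ds} → as ++ x ∷ bs ≡ cs ++ y ∷ ds →
    x ∈ₗ cs ⊎ ∃ λ es → as ∷ʳ x ≡ cs ++ y ∷ es
  ∈⊎prefix []       []       refl = inj₂ ([] , refl)
  ∈⊎prefix (a ∷ as) []       refl = inj₂ (as ∷ʳ _ , refl)
  ∈⊎prefix []       (c ∷ cs) refl = inj₁ (here refl)
  ∈⊎prefix (a ∷ as) (c ∷ cs) eq   with refl , eq′ ← ∷-injective eq with ∈⊎prefix as cs eq′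
  ... | inj₁ x∈cs        = inj₁ (there x∈cs)
  ... | inj₂ (es , eq″)  = inj₂ (es , cong (_ ∷_) eq″)

  ∈⊎suffix : ∀ (as cs : List A) {x y bs ds} → as ++ x ∷ bs ≡ cs ++ y ∷ ds →
    x ∈ₗ ds ⊎ ∃ λ es → x ∷ bs ≡ es ++ y ∷ ds
  ∈⊎suffix []       []       refl = inj₂ ([] , refl)
  ∈⊎suffix []       (c ∷ cs) refl = inj₂ (c ∷ cs , refl)
  ∈⊎suffix (a ∷ as) []       refl = inj₁ (∈-++⁺ʳ as (here refl))
  ∈⊎suffix (a ∷ as) (c ∷ cs) eq   with refl , eq′ ← ∷-injective eq = ∈⊎suffix as cs eq′

reverse-++-∷ : ∀ {A : Set} (as : List A) x bs → reverse (as ++ x ∷ bs) ≡ reverse bs ++ x ∷ reverse as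
reverse-++-∷ as x bs = trans (reverse-++ as (x ∷ bs))
  (trans (cong (_++ reverse as) (unfold-reverse x bs)) (++-assoc (reverse bs) (x ∷ []) (reverse as)))

reverse-≡-++-∷ : ∀ {A : Set} {as : List A} cs x ds → reverse as ≡ cs ++ x ∷ ds → as ≡ reverse ds ++ x ∷ reverse cs
reverse-≡-++-∷ {as = as} cs x ds eq =
  trans (sym (reverse-involutive as)) (trans (cong reverse eq) (reverse-++-∷ cs x ds))

module Lex {A : Set} (_≺_ : Rel A 0ℓ) (≺-trans : Transitive _≺_) (≺-irrefl : ∀ x → ¬ x ≺ x) where

  _≤ₗ_ : Rel (List A) 0ℓ
  _≤ₗ_ = Lex-≤ _≡_ _≺_

  _<ₗ_ : Rel (List A) 0ℓ
  as <ₗ bs = as ≤ₗ bs × ¬ bs ≤ₗ as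

  ≤ₗ-trans : Transitive _≤ₗ_
  ≤ₗ-trans = ≤-transitive isEquivalence (resp₂ _≺_) ≺-trans

  <ₗ-trans : Transitive _<ₗ_
  <ₗ-trans (as≤bs , bs≰as) (bs≤cs , cs≰bs) = ≤ₗ-trans as≤bs bs≤cs , λ cs≤as → cs≰bs (≤ₗ-trans cs≤as as≤bs)

  <ₗ-irrefl : ∀ as → ¬ as <ₗ as
  <ₗ-irrefl as (as≤as , as≰as) = as≰as as≤as

  []≤ₗ : ∀ bs → [] ≤ₗ bs
  []≤ₗ []      = base tt
  []≤ₗ (_ ∷ _) = halt

  ≮ₗ[] : ∀ as → ¬ as <ₗ []
  ≮ₗ[] as (_ , []≰as) = []≰as ([]≤ₗ as)

  ≮⇒¬¬≥ : ∀ {as bs} → as ≤ₗ bs ⊎ bs ≤ₗ as → ¬ as <ₗ bs → ¬ ¬ bs ≤ₗ as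
  ≮⇒¬¬≥ (inj₁ as≤bs) as≮bs bs≰as = as≮bs (as≤bs , bs≰as)
  ≮⇒¬¬≥ (inj₂ bs≤as) _     bs≰as = bs≰as bs≤as

  ≤ₗ-++⁺ : ∀ cs {as bs} → as ≤ₗ bs → (cs ++ as) ≤ₗ (cs ++ bs)
  ≤ₗ-++⁺ []       as≤bs = as≤bs
  ≤ₗ-++⁺ (c ∷ cs) as≤bs = next refl (≤ₗ-++⁺ cs as≤bs)

  ≤ₗ-++⁻ : ∀ cs {as bs} → (cs ++ as) ≤ₗ (cs ++ bs) → as ≤ₗ bs
  ≤ₗ-++⁻ []       as≤bs          = as≤bs
  ≤ₗ-++⁻ (c ∷ cs) (this c≺c)     = contradiction c≺c (≺-irrefl c)
  ≤ₗ-++⁻ (c ∷ cs) (next _ as≤bs) = ≤ₗ-++⁻ cs as≤bs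

  <ₗ-++⁺ : ∀ cs {as bs} → as <ₗ bs → (cs ++ as) <ₗ (cs ++ bs)
  <ₗ-++⁺ cs (as≤bs , bs≰as) = ≤ₗ-++⁺ cs as≤bs , λ bs≤as → bs≰as (≤ₗ-++⁻ cs bs≤as)

  <ₗ-++⁻ : ∀ cs {as bs} → (cs ++ as) <ₗ (cs ++ bs) → as <ₗ bs
  <ₗ-++⁻ cs (as≤bs , bs≰as) = ≤ₗ-++⁻ cs as≤bs , λ bs≤as → bs≰as (≤ₗ-++⁺ cs bs≤as)

  <ₗ-branch : ∀ cs {j k as bs} → j ≺ k → (cs ++ j ∷ as) <ₗ (cs ++ k ∷ bs)
  <ₗ-branch cs {j} j≺k = <ₗ-++⁺ cs (this j≺k , λ { (this k≺j) → ≺-irrefl j (≺-trans j≺k k≺j)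
                                                 ; (next refl _) → ≺-irrefl j j≺k })

  Branch : Rel (List A) 0ℓ
  Branch as bs = ∃ λ cs → ∃₂ λ j k → ∃₂ λ as′ bs′ →
    as ≡ cs ++ j ∷ as′ × bs ≡ cs ++ k ∷ bs′ × j ≺ k

  <ₗ⇒extension⊎branch : ∀ {as bs} → as <ₗ bs → (∃₂ λ x xs → bs ≡ as ++ x ∷ xs) ⊎ Branch as bs
  <ₗ⇒extension⊎branch (base _        , []≰[]) = contradiction (base tt) []≰[]
  <ₗ⇒extension⊎branch (halt          , _)     = inj₁ (_ , _ , refl)
  <ₗ⇒extension⊎branch (this j≺k      , _)     = inj₂ ([] , _ , _ , _ , _ , refl , refl , j≺k)
  <ₗ⇒extension⊎branch (next {x} refl as≤bs , bs≰as)
    with <ₗ⇒extension⊎branch (as≤bs , λ bs≤as → bs≰as (next refl bs≤as))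
  ... | inj₁ (y , ys , eq)                        = inj₁ (y , ys , cong (x ∷_) eq)
  ... | inj₂ (cs , j , k , as′ , bs′ , e₁ , e₂ , j≺k) =
    inj₂ (x ∷ cs , j , k , as′ , bs′ , cong (x ∷_) e₁ , cong (x ∷_) e₂ , j≺k)

  <ₗ-isStrictPartialOrder : IsStrictPartialOrder _≡_ _<ₗ_
  <ₗ-isStrictPartialOrder = record
    { isEquivalence = isEquivalence
    ; irrefl        = λ { refl → <ₗ-irrefl _ }
    ; trans         = <ₗ-trans
    ; <-resp-≈      = resp₂ _<ₗ_
    }

  _<ʳ_ : Rel (List A) 0ℓ
  as <ʳ bs = reverse as <ₗ reverse bs

  <ʳ-irrefl : ∀ as → ¬ as <ʳ as
  <ʳ-irrefl as = <ₗ-irrefl (reverse as)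

  <ʳ-isStrictPartialOrder : IsStrictPartialOrder _≡_ _<ʳ_
  <ʳ-isStrictPartialOrder = record
    { isEquivalence = isEquivalence
    ; irrefl        = λ { {as} refl → <ʳ-irrefl as }
    ; trans         = λ {as} {bs} {cs} → <ₗ-trans {reverse as} {reverse bs} {reverse cs}
    ; <-resp-≈      = resp₂ _<ʳ_
    }

  <ʳ-++⁺ : ∀ cs {as bs} → as <ʳ bs → (as ++ cs) <ʳ (bs ++ cs)
  <ʳ-++⁺ cs {as} {bs} as<bs =
    subst₂ _<ₗ_ (sym (reverse-++ as cs)) (sym (reverse-++ bs cs)) (<ₗ-++⁺ (reverse cs) as<bs)

  <ʳ-++⁻ : ∀ cs {as bs} → (as ++ cs) <ʳ (bs ++ cs) → as <ʳ bs
  <ʳ-++⁻ cs {as} {bs} as<bs = <ₗ-++⁻ (reverse cs) (subst₂ _<ₗ_ (reverse-++ as cs) (reverse-++ bs cs) as<bs)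

  <ʳ-branch : ∀ as bs cs {j k} → j ≺ k → (as ++ j ∷ cs) <ʳ (bs ++ k ∷ cs)
  <ʳ-branch as bs cs j≺k =
    subst₂ _<ₗ_ (sym (reverse-++-∷ as _ cs)) (sym (reverse-++-∷ bs _ cs)) (<ₗ-branch (reverse cs) j≺k)

  CoBranch : Rel (List A) 0ℓ
  CoBranch as bs = ∃ λ cs → ∃₂ λ j k → ∃₂ λ as′ bs′ →
    as ≡ as′ ++ j ∷ cs × bs ≡ bs′ ++ k ∷ cs × j ≺ k

  <ʳ⇒extension⊎cobranch : ∀ {as bs} → as <ʳ bs → (∃₂ λ x xs → bs ≡ xs ++ x ∷ as) ⊎ CoBranch as bs
  <ʳ⇒extension⊎cobranch {as} as<bs with <ₗ⇒extension⊎branch as<bs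
  ... | inj₁ (x , xs , eq) =
    inj₁ (x , reverse xs ,
          trans (reverse-≡-++-∷ (reverse as) x xs eq) (cong (λ ys → reverse xs ++ x ∷ ys) (reverse-involutive as)))
  ... | inj₂ (cs , j , k , as′ , bs′ , e₁ , e₂ , j≺k) =
    inj₂ (reverse cs , j , k , reverse as′ , reverse bs′ ,
          reverse-≡-++-∷ cs j as′ e₁ , reverse-≡-++-∷ cs k bs′ e₂ , j≺k)

-- Trail src tgt is Chain, and Trail tgt src runs along a chain backwards, as the incoming order reads prefixes.
module _ {V A : Set} (start end : A → V) where

  data Trail : V → List A → V → Set where
    []  : ∀ {v} → Trail v [] v
    _∷_ : ∀ {v w e es} → start e ≡ v → Trail (end e) es w → Trail v (e ∷ es) w

  trail-∷ʳ : ∀ {v e es} → Trail v es (start e) → Trail v (es ∷ʳ e) (end e)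
  trail-∷ʳ []       = refl ∷ []
  trail-∷ʳ (s ∷ tr) = s ∷ trail-∷ʳ tr

  -- Framing orders only compare edges at internal vertices, hence the requirement that the vertex is entered.
  module _ (_≺_ : Rel A 0ℓ) (_≟ₐ_ : DecidableEquality A)
    (≺-connex : ∀ {e e′} → start e ≡ start e′ → (∃ λ h → end h ≡ start e) → e ≢ e′ → e ≺ e′ ⊎ e′ ≺ e) where

    trail-total : ∀ {v as bs w w′} → (∃ λ h → end h ≡ v) → Trail v as w → Trail v bs w′ →
      Lex-≤ _≡_ _≺_ as bs ⊎ Lex-≤ _≡_ _≺_ bs as
    trail-total _ []       []       = inj₁ (base tt)
    trail-total _ []       (_ ∷ _)  = inj₁ halt
    trail-total _ (_ ∷ _)  []       = inj₂ halt
    trail-total entered (_∷_ {e = x} sx xs) (_∷_ {e = y} sy ys) with x ≟ₐ y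
    ... | yes refl = Sum.map (next refl) (next refl) (trail-total (x , refl) xs ys)
    ... | no x≢y   =
      Sum.map this this (≺-connex (trans sx (sym sy)) (subst (λ u → ∃ λ h → end h ≡ u) (sym sx) entered) x≢y)

module _ (G : FlowGraph) (F : Framing G) where
  open Framed G F

  module OutLex = Lex _<out_ out-trans out-irrefl
  module InLex  = Lex _<in_ in-trans in-irrefl

  chain-++ : ∀ {a b c xs ys} → Chain a xs b → Chain b ys c → Chain a (xs ++ ys) c
  chain-++ []      q = q
  chain-++ (s ∷ p) q = s ∷ chain-++ p q

  chain-++⁻ : ∀ xs {a ys c} → Chain a (xs ++ ys) c → ∃ λ b → Chain a xs b × Chain b ys c
  chain-++⁻ []       p       = _ , [] , p
  chain-++⁻ (x ∷ xs) (s ∷ p) with b , p₁ , p₂ ← chain-++⁻ xs p = b , s ∷ p₁ , p₂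

  chain-end-unique : ∀ {a xs b b′} → Chain a xs b → Chain a xs b′ → b ≡ b′
  chain-end-unique []      []      = refl
  chain-end-unique (_ ∷ p) (_ ∷ q) = chain-end-unique p q

  chain-start-unique : ∀ {a a′ xs b} → Chain a xs b → Chain a′ xs b → a ≡ a′
  chain-start-unique []      []      = refl
  chain-start-unique (s ∷ _) (s′ ∷ _) = trans (sym s) s′

  chain-length : ∀ {a xs b} → Chain a xs b → toℕ a + length xs ≤ toℕ b
  chain-length []                  = ≤-reflexive (+-identityʳ _)
  chain-length (_∷_ {e = e} refl p) =
    ≤-trans (≤-reflexive (+-suc _ _)) (≤-trans (+-monoˡ-≤ _ (src<tgt e)) (chain-length p))

  chain-length≤n : ∀ {a xs b} → Chain a xs b → length xs ≤ n
  chain-length≤n {a} {b = b} p = ≤-trans (m+n≤o⇒n≤o (toℕ a) (chain-length p)) (<⇒≤ (toℕ<n b))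

  ¬cycle : ∀ {a x xs} → ¬ Chain a (x ∷ xs) a
  ¬cycle {a} p = m+1+n≰m (toℕ a) (chain-length p)

  chain-prefix-unique : ∀ p₁ q₁ {a v p₂ q₂} → Chain a p₁ v → Chain a q₁ v → p₁ ++ p₂ ≡ q₁ ++ q₂ → p₁ ≡ q₁
  chain-prefix-unique []       []       _        _        _  = refl
  chain-prefix-unique []       (_ ∷ _)  []       q        _  = contradiction q ¬cycle
  chain-prefix-unique (_ ∷ _)  []       p        []       _  = contradiction p ¬cycle
  chain-prefix-unique (x ∷ p₁) (_ ∷ q₁) (_ ∷ p)  (_ ∷ q)  eq with refl , eq′ ← ∷-injective eq =
    cong (x ∷_) (chain-prefix-unique p₁ q₁ p q eq′)

  chain-∷ʳ-view : ∀ {a ys b} → Chain a ys b → (ys ≡ [] × a ≡ b) ⊎ ∃₂ λ ys′ j → ys ≡ ys′ ∷ʳ j × tgt j ≡ b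
  chain-∷ʳ-view []                 = inj₁ (refl , refl)
  chain-∷ʳ-view (_∷_ {e = x} _ p) with chain-∷ʳ-view p
  ... | inj₁ (refl , refl)        = inj₂ ([] , x , refl , refl)
  ... | inj₂ (ys′ , j , refl , t) = inj₂ (x ∷ ys′ , j , refl , t)

  chain-into-source : ∀ {a xs b} → Chain a xs b → Source b → xs ≡ []
  chain-into-source p b-source with chain-∷ʳ-view p
  ... | inj₁ (refl , _)     = refl
  ... | inj₂ (_ , j , _ , tj) = contradiction (j , tj) b-source

  chain-from-sink : ∀ {a xs b} → Chain a xs b → Sink a → xs ≡ []
  chain-from-sink []                 _  = refl
  chain-from-sink (_∷_ {e = x} s _) sk = contradiction (x , s) sk

  ¬extend-into-source : ∀ {a a′ v xs ys x} → Chain a xs v → Source a → ¬ Chain a′ (ys ++ x ∷ xs) v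
  ¬extend-into-source {ys = ys} {x} p a-source q with _ , _ , _∷_ _ q′ ← chain-++⁻ ys q =
    a-source (x , chain-start-unique q′ p)

  ¬extend-from-sink : ∀ {v w w′ xs x ys} → Chain v xs w → Sink w → ¬ Chain v (xs ++ x ∷ ys) w′
  ¬extend-from-sink {xs = xs} {x} p sk q with _ , q₁ , s ∷ _ ← chain-++⁻ xs q =
    sk (x , trans s (chain-end-unique q₁ p))

  route-suffix : ∀ {z z₁ z₂ v} → IsRoute z → Through z v z₁ z₂ → ∃ λ w → Chain v z₂ w × Sink w
  route-suffix {z₁ = z₁} (_ , w , p , sk) (refl , q)
    with _ , p₁ , p₂ ← chain-++⁻ z₁ p
    with refl ← chain-end-unique q p₁ = w , p₂ , sk

  route-prefix : ∀ {z z₁ j z₂} → IsRoute z → proj₂ z ≡ z₁ ++ j ∷ z₂ → Chain (proj₁ z) z₁ (src j)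
  route-prefix {z₁ = z₁} (_ , _ , p , _) refl with _ , p₁ , s ∷ _ ← chain-++⁻ z₁ p = subst (Chain _ z₁) (sym s) p₁

  outLt-branch : ∀ {v p q w w′} → Chain v p w → Sink w → Chain v q w′ → Sink w′ → OutLt p q → OutLex.Branch p q
  outLt-branch p skp q _ p<q with OutLex.<ₗ⇒extension⊎branch p<q
  ... | inj₁ (_ , _ , refl) = contradiction q (¬extend-from-sink p skp)
  ... | inj₂ branch         = branch

  inLt-cobranch : ∀ {a b v p q} → Chain a p v → Source a → Chain b q v → Source b → InLt p q → InLex.CoBranch p q
  inLt-cobranch {p = p} {q} cp a-source cq _ p<q with InLex.<ʳ⇒extension⊎cobranch {p} {q} p<q
  ... | inj₁ (_ , _ , refl) = contradiction cq (¬extend-into-source cp a-source)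
  ... | inj₂ cobranch       = cobranch

  outLeq-total : ∀ {v p q w w′} → (∃ λ h → tgt h ≡ v) → Chain v p w → Chain v q w′ → OutLeq p q ⊎ OutLeq q p
  outLeq-total entering p q = trail-total src tgt _<out_ _≟_ connex entering (forward p) (forward q)
    where
    connex : ∀ {e e′} → src e ≡ src e′ → (∃ λ h → tgt h ≡ src e) → e ≢ e′ → e <out e′ ⊎ e′ <out e
    connex {e} eq (h , eh) = out-total e _ eq ((λ source → source (h , eh)) , (λ sink → sink (e , refl)))
    forward : ∀ {a xs b} → Chain a xs b → Trail src tgt a xs b
    forward []      = []
    forward (s ∷ p) = s ∷ forward p

  inLeq-total : ∀ {a b v p q} → (∃ λ h → src h ≡ v) → Chain a p v → Chain b q v → InLeq p q ⊎ InLeq q p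
  inLeq-total leaving p q = trail-total tgt src _<in_ _≟_ connex leaving (backward p) (backward q)
    where
    connex : ∀ {e e′} → tgt e ≡ tgt e′ → (∃ λ h → src h ≡ tgt e) → e ≢ e′ → e <in e′ ⊎ e′ <in e
    connex {e} eq (h , eh) = in-total e _ eq ((λ source → source (e , refl)) , (λ sink → sink (h , eh)))
    backward : ∀ {a xs b} → Chain a xs b → Trail tgt src b (reverse xs) a
    backward []                 = []
    backward (_∷_ {e = x} {es} refl p) =
      subst (λ ys → Trail tgt src _ ys _) (sym (unfold-reverse x es)) (trail-∷ʳ tgt src (backward p))

  through-src : ∀ {z z₁ j z₂} → IsRoute z → proj₂ z ≡ z₁ ++ j ∷ z₂ → Through z (src j) z₁ (j ∷ z₂)
  through-src rz ez = ez , route-prefix rz ez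

  through-tgt : ∀ {z z₁ j z₂} → IsRoute z → proj₂ z ≡ z₁ ++ j ∷ z₂ → Through z (tgt j) (z₁ ∷ʳ j) z₂
  through-tgt {z₁ = z₁} {j} {z₂} rz ez =
    trans ez (sym (++-assoc z₁ (j ∷ []) z₂)) , chain-++ (route-prefix rz ez) (refl ∷ [])

  -- Clockwise, judged only by the first edges after a common vertex (fork) or the last edges before it (join).
  ClockwiseAtFork : List Edge → Edge → List Edge → Edge → Set
  ClockwiseAtFork p k q j = InLt p q × j <out k

  ClockwiseAtJoin : Edge → List Edge → Edge → List Edge → Set
  ClockwiseAtJoin k p j q = k <in j × OutLt q p

  CrossAtFork : List Edge → Edge → List Edge → Edge → Set
  CrossAtFork p k q j = ClockwiseAtFork p k q j ⊎ ClockwiseAtFork q j p k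

  CrossAtJoin : Edge → List Edge → Edge → List Edge → Set
  CrossAtJoin k p j q = ClockwiseAtJoin k p j q ⊎ ClockwiseAtJoin j q k p

  Crossing : List Edge → List Edge → List Edge → List Edge → Set
  Crossing p₁ p₂ q₁ q₂ = (InLt p₁ q₁ × OutLt q₂ p₂) ⊎ (InLt q₁ p₁ × OutLt p₂ q₂)

  clockwiseAtFork⇒clockwise : ∀ {z z′ p k p′ q j q′} → IsRoute z → IsRoute z′ →
    proj₂ z ≡ p ++ k ∷ p′ → proj₂ z′ ≡ q ++ j ∷ q′ → ClockwiseAtFork p k q j → Clockwise z z′ (src k)
  clockwiseAtFork⇒clockwise {p = p} {k} {p′} {q} {j} {q′} rz rz′ ez ez′ (p<q , j<k) =
    subst Internal (out-src j<k) (out-internal j<k) , p , k ∷ p′ , q , j ∷ q′ ,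
    through-src rz ez , subst (λ v → Through _ v q (j ∷ q′)) (out-src j<k) (through-src rz′ ez′) ,
    p<q , OutLex.<ₗ-branch [] j<k

  clockwiseAtJoin⇒clockwise : ∀ {z z′ p′ k p q′ j q} → IsRoute z → IsRoute z′ →
    proj₂ z ≡ p′ ++ k ∷ p → proj₂ z′ ≡ q′ ++ j ∷ q → ClockwiseAtJoin k p j q → Clockwise z z′ (tgt k)
  clockwiseAtJoin⇒clockwise {p′ = p′} {k} {p} {q′} {j} {q} rz rz′ ez ez′ (k<j , q<p) =
    in-internal k<j , p′ ∷ʳ k , p , q′ ∷ʳ j , q ,
    through-tgt rz ez , subst (λ v → Through _ v (q′ ∷ʳ j) q) (sym (in-tgt k<j)) (through-tgt rz′ ez′) ,
    InLex.<ʳ-branch p′ q′ [] k<j , q<p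

  -- Routes start at sources and end at sinks, so neither prefix (suffix) properly extends the other:
  -- routes crossing at v also cross at the fork after v and at the join before v.
  crossing⇒crossAtFork : ∀ {v p₁ p₂ q₁ q₂ w w′} → Chain v p₂ w → Sink w → Chain v q₂ w′ → Sink w′ →
    Crossing p₁ p₂ q₁ q₂ → ∃ λ c → ∃₂ λ k j → ∃₂ λ p′ q′ →
      p₂ ≡ c ++ k ∷ p′ × q₂ ≡ c ++ j ∷ q′ × CrossAtFork (p₁ ++ c) k (q₁ ++ c) j
  crossing⇒crossAtFork {p₁ = p₁} {q₁ = q₁} cp skp cq skq (inj₁ (p₁<q₁ , q₂<p₂))
    with c , j , k , q′ , p′ , eq , ep , j<k ← outLt-branch cq skq cp skp q₂<p₂ =
    c , k , j , p′ , q′ , ep , eq , inj₁ (InLex.<ʳ-++⁺ c {p₁} {q₁} p₁<q₁ , j<k)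
  crossing⇒crossAtFork {p₁ = p₁} {q₁ = q₁} cp skp cq skq (inj₂ (q₁<p₁ , p₂<q₂))
    with c , k , j , p′ , q′ , ep , eq , k<j ← outLt-branch cp skp cq skq p₂<q₂ =
    c , k , j , p′ , q′ , ep , eq , inj₂ (InLex.<ʳ-++⁺ c {q₁} {p₁} q₁<p₁ , k<j)

  crossing⇒crossAtJoin : ∀ {a b v p₁ p₂ q₁ q₂} → Chain a p₁ v → Source a → Chain b q₁ v → Source b →
    Crossing p₁ p₂ q₁ q₂ → ∃ λ c → ∃₂ λ k j → ∃₂ λ p′ q′ →
      p₁ ≡ p′ ++ k ∷ c × q₁ ≡ q′ ++ j ∷ c × CrossAtJoin k (c ++ p₂) j (c ++ q₂)
  crossing⇒crossAtJoin cp sp cq sq (inj₁ (p₁<q₁ , q₂<p₂))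
    with c , k , j , p′ , q′ , ep , eq , k<j ← inLt-cobranch cp sp cq sq p₁<q₁ =
    c , k , j , p′ , q′ , ep , eq , inj₁ (k<j , OutLex.<ₗ-++⁺ c q₂<p₂)
  crossing⇒crossAtJoin cp sp cq sq (inj₂ (q₁<p₁ , p₂<q₂))
    with c , j , k , q′ , p′ , eq , ep , j<k ← inLt-cobranch cq sq cp sp q₁<p₁ =
    c , k , j , p′ , q′ , ep , eq , inj₂ (j<k , OutLex.<ₗ-++⁺ c p₂<q₂)

  -- Every edge lies on a route of a maximal clique

  module Clique (Δ : Pred Walk 0ℓ) (Δ-clique : IsClique Δ) where

    Δ-route : ∀ {z} → z ∈ Δ → IsRoute z
    Δ-route = proj₁ Δ-clique

    Δ-¬clockwise : ∀ {z z′ v} → z ∈ Δ → z′ ∈ Δ → ¬ Clockwise z z′ v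
    Δ-¬clockwise zΔ z′Δ = proj₁ (proj₂ Δ-clique zΔ z′Δ _)

    Unused : Edge → Set
    Unused k = ∀ {z} → z ∈ Δ → k ∉ₗ proj₂ z

    ForkCoherentAt : List Edge → Edge → Set
    ForkCoherentAt p k = ∀ {z} → z ∈ Δ → ∀ {z₁ j z₂} → proj₂ z ≡ z₁ ++ j ∷ z₂ → ¬ CrossAtFork p k z₁ j

    ForkCoherent : List Edge → Set
    ForkCoherent q = ∀ {p k p′} → q ≡ p ++ k ∷ p′ → ForkCoherentAt p k

    JoinCoherentAt : Edge → List Edge → Set
    JoinCoherentAt k p = ∀ {z} → z ∈ Δ → ∀ {z₁ j z₂} → proj₂ z ≡ z₁ ++ j ∷ z₂ → ¬ CrossAtJoin k p j z₂

    JoinCoherent : List Edge → Set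
    JoinCoherent q = ∀ {p′ k p} → q ≡ p′ ++ k ∷ p → JoinCoherentAt k p

    Δ-forkCoherentAt : ∀ {zs p k p′} → zs ∈ Δ → proj₂ zs ≡ p ++ k ∷ p′ → ForkCoherentAt p k
    Δ-forkCoherentAt zsΔ ezs zΔ ez (inj₁ cw) =
      Δ-¬clockwise zsΔ zΔ (clockwiseAtFork⇒clockwise (Δ-route zsΔ) (Δ-route zΔ) ezs ez cw)
    Δ-forkCoherentAt zsΔ ezs zΔ ez (inj₂ cw) =
      Δ-¬clockwise zΔ zsΔ (clockwiseAtFork⇒clockwise (Δ-route zΔ) (Δ-route zsΔ) ez ezs cw)

    Δ-joinCoherentAt : ∀ {zs p′ k p} → zs ∈ Δ → proj₂ zs ≡ p′ ++ k ∷ p → JoinCoherentAt k p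
    Δ-joinCoherentAt zsΔ ezs zΔ ez (inj₁ cw) =
      Δ-¬clockwise zsΔ zΔ (clockwiseAtJoin⇒clockwise (Δ-route zsΔ) (Δ-route zΔ) ezs ez cw)
    Δ-joinCoherentAt zsΔ ezs zΔ ez (inj₂ cw) =
      Δ-¬clockwise zΔ zsΔ (clockwiseAtJoin⇒clockwise (Δ-route zΔ) (Δ-route zsΔ) ez ezs cw)

    Δ-forkCoherent : ∀ {zs q rest} → zs ∈ Δ → proj₂ zs ≡ q ++ rest → ForkCoherent q
    Δ-forkCoherent {rest = rest} zsΔ ezs {p} {k} {p′} refl =
      Δ-forkCoherentAt zsΔ (trans ezs (++-assoc p (k ∷ p′) rest))

    Δ-joinCoherent : ∀ {zs rest q} → zs ∈ Δ → proj₂ zs ≡ rest ++ q → JoinCoherent q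
    Δ-joinCoherent {rest = rest} zsΔ ezs {p′} refl = Δ-joinCoherentAt zsΔ (++-reassoc rest p′ ezs refl)

    forkCoherent-[] : ForkCoherent []
    forkCoherent-[] {p} eq = contradiction (sym eq) (++-∷≢[] p)

    forkCoherent-∷ʳ : ∀ {q k} → ForkCoherent q → ForkCoherentAt q k → ForkCoherent (q ∷ʳ k)
    forkCoherent-∷ʳ fc fcAt {p} eq with ++-∷≡∷ʳ p (sym eq)
    ... | inj₁ (refl , refl) = fcAt
    ... | inj₂ (_ , q≡)      = fc q≡

    joinCoherent-[] : JoinCoherent []
    joinCoherent-[] {p′} eq = contradiction (sym eq) (++-∷≢[] p′)

    joinCoherent-∷ : ∀ {k q} → JoinCoherentAt k q → JoinCoherent q → JoinCoherent (k ∷ q)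
    joinCoherent-∷ jcAt _  {[]}     refl = jcAt
    joinCoherent-∷ _    jc {_ ∷ p′} refl = jc refl

    -- A crossing of P k S with z propagates to a fork on P k or to a join on k S,
    -- because z does not use k.
    spliced-coherent : ∀ {a b P k S} → Source a → Chain a (P ++ k ∷ S) b → Sink b → Unused k →
      ForkCoherent (P ∷ʳ k) → JoinCoherent (k ∷ S) → ∀ {z} → z ∈ Δ → Coherent (a , P ++ k ∷ S) z
    spliced-coherent {a} {b} {P} {k} {S} sa cT sb unused fc jc {z} zΔ v =
        (λ (_ , _ , _ , _ , _ , tT , tz , l , l′) → uncrossed tT tz (inj₁ (l , l′)))
      , (λ (_ , _ , _ , _ , _ , tz , tT , l , l′) → uncrossed tT tz (inj₂ (l , l′)))
      where
      uses : ∀ {xs} → proj₂ z ≡ xs → k ∉ₗ xs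
      uses ez k∈xs = unused zΔ (subst (k ∈ₗ_) (sym ez) k∈xs)

      uncrossed : ∀ {t₁ t₂ z₁ z₂} → Through (a , P ++ k ∷ S) v t₁ t₂ → Through z v z₁ z₂ → ¬ Crossing t₁ t₂ z₁ z₂
      uncrossed {t₁} {t₂} {z₁} {z₂} (et , ct) (ez , cz) cross with ++-∷≡++ P t₁ et
      ... | inj₁ (P₂ , P≡ , t₂≡)
        with _ , ct₂ , skt ← route-suffix (sa , b , cT , sb) (et , ct)
        with _ , cz₂ , skz ← route-suffix (Δ-route zΔ) (ez , cz)
        with c , k′ , j , t′ , z′ , et₂ , ez₂ , fork
               ← crossing⇒crossAtFork {p₁ = t₁} {q₁ = z₁} ct₂ skt cz₂ skz cross
        with ∈⊎prefix P₂ c (trans (sym t₂≡) et₂)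
      ... | inj₁ k∈c      = uses (trans ez (cong (z₁ ++_) ez₂)) (∈-++⁺ʳ z₁ (∈-++⁺ˡ k∈c))
      ... | inj₂ (_ , P₂k≡) =
        fc (++-reassoc t₁ c (trans (cong (_∷ʳ k) P≡) (++-assoc t₁ P₂ (k ∷ []))) P₂k≡) zΔ (++-reassoc z₁ c ez ez₂) fork
      uncrossed {t₁} {t₂} {z₁} {z₂} (et , ct) (ez , cz) cross | inj₂ (S₁ , t₁≡ , S≡)
        with c , k′ , j , t′ , z′ , et₁ , ez₁ , join
               ← crossing⇒crossAtJoin {p₂ = t₂} {q₂ = z₂} ct sa cz (proj₁ (Δ-route zΔ)) cross
        with ∈⊎suffix P t′ (trans (sym t₁≡) et₁)
      ... | inj₁ k∈c        = uses (trans ez (cong (_++ z₂) ez₁)) (∈-++⁺ˡ (∈-++⁺ʳ z′ (there k∈c)))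
      ... | inj₂ (L , kS₁≡) =
        jc {L} (trans (cong (k ∷_) S≡) (trans (cong (_++ t₂) kS₁≡) (++-assoc L (k′ ∷ c) t₂))) zΔ
           (trans ez (trans (cong (_++ z₂) ez₁) (++-assoc z′ (j ∷ c) z₂))) join

    Leaves : Vertex → Set
    Leaves x = ∃ λ z → z ∈ Δ × ∃₂ λ z₁ j → ∃ λ z₂ → proj₂ z ≡ z₁ ++ j ∷ z₂ × src j ≡ x

    Enters : Vertex → Set
    Enters y = ∃ λ z → z ∈ Δ × ∃₂ λ z₁ j → ∃ λ z₂ → proj₂ z ≡ z₁ ++ j ∷ z₂ × tgt j ≡ y

    Δ-prefix∈lists≤ : ∀ {z z₁ j z₂} → z ∈ Δ → proj₂ z ≡ z₁ ++ j ∷ z₂ → z₁ ∈ₗ lists≤ n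
    Δ-prefix∈lists≤ {z₁ = z₁} zΔ ez = ∈-lists≤ n z₁ (chain-length≤n (route-prefix (Δ-route zΔ) ez))

    Δ-suffix∈lists≤ : ∀ {z z₁ j z₂} → z ∈ Δ → proj₂ z ≡ z₁ ++ j ∷ z₂ → z₂ ∈ₗ lists≤ n
    Δ-suffix∈lists≤ {z₂ = z₂} zΔ ez with _ , cz₂ , _ ← route-suffix (Δ-route zΔ) (through-tgt (Δ-route zΔ) ez) =
      ∈-lists≤ n z₂ (chain-length≤n cz₂)

    LeavesBelow LeavesAbove : Edge → List Edge → Set
    LeavesBelow k p = ∃ λ z → z ∈ Δ × ∃₂ λ j z₂ → proj₂ z ≡ p ++ j ∷ z₂ × j <out k
    LeavesAbove k p = ∃ λ z → z ∈ Δ × ∃₂ λ j z₂ → proj₂ z ≡ p ++ j ∷ z₂ × k <out j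

    CoherentPrefix : Edge → Set
    CoherentPrefix k = ∃₂ λ a P → Source a × Chain a P (src k) × ForkCoherent (P ∷ʳ k)

    prefix-from-route : ∀ {k zs P j rest} → zs ∈ Δ → proj₂ zs ≡ P ++ j ∷ rest → src j ≡ src k →
      ForkCoherentAt P k → CoherentPrefix k
    prefix-from-route {zs = zs} {P} zsΔ ezs sj fcAt =
      proj₁ zs , P , proj₁ (Δ-route zsΔ) , subst (Chain (proj₁ zs) P) sj (route-prefix (Δ-route zsΔ) ezs) ,
      forkCoherent-∷ʳ (Δ-forkCoherent zsΔ ezs) fcAt

    -- Copy the prefix that is largest in the incoming order among routes of Δ leaving src k below k:
    -- a route crossing P k at src k would exceed it or cross the copied route.
    prefix-below : ∀ {k p} → LeavesBelow k p → ¬ ¬ CoherentPrefix k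
    prefix-below {k} below = do
      P , (_ , zΔ , j , _ , ez , j<k) , P-max ← ¬¬-maximal InLex.<ʳ-isStrictPartialOrder (LeavesBelow k) (lists≤ n) below
      pure (prefix-from-route zΔ ez (out-src j<k) λ where
        z′Δ ez′ (inj₁ (P<z₁ , j′<k)) → P-max (Δ-prefix∈lists≤ z′Δ ez′) (_ , z′Δ , _ , _ , ez′ , j′<k) P<z₁
        z′Δ ez′ (inj₂ (z₁<P , k<j′)) → Δ-forkCoherentAt z′Δ ez′ zΔ ez (inj₁ (z₁<P , out-trans j<k k<j′)))

    prefix-above : ∀ {k p} → ¬ ∃ (LeavesBelow k) → LeavesAbove k p → ¬ ¬ CoherentPrefix k
    prefix-above {k} ¬below above = do
      P , (_ , zΔ , j , _ , ez , k<j) , P-min ←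
        ¬¬-maximal (Flip.isStrictPartialOrder InLex.<ʳ-isStrictPartialOrder) (LeavesAbove k) (lists≤ n) above
      pure (prefix-from-route zΔ ez (sym (out-src k<j)) λ where
        z′Δ ez′ (inj₁ (_ , j′<k))    → ¬below (_ , _ , z′Δ , _ , _ , ez′ , j′<k)
        z′Δ ez′ (inj₂ (z₁<P , k<j′)) → P-min (Δ-prefix∈lists≤ z′Δ ez′) (_ , z′Δ , _ , _ , ez′ , k<j′) z₁<P)

    prefix-leaving : ∀ {k} → ¬ Source (src k) → Unused k → Leaves (src k) → ¬ ¬ CoherentPrefix k
    prefix-leaving {k} ¬source unused (z , zΔ , z₁ , j , z₂ , ez , sj) = do
      no ¬below ← ¬¬-excluded-middle {A = ∃ (LeavesBelow k)}
        where yes (_ , below) → prefix-below below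
      [ (λ j<k → contradiction (z₁ , z , zΔ , j , z₂ , ez , j<k) ¬below) ,
        (λ k<j → prefix-above ¬below (z , zΔ , j , z₂ , ez , k<j)) ]′ (out-total j k sj internal j≢k)
      where
      internal : Internal (src j)
      internal = (λ source → ¬source (subst Source sj source)) , (λ sink → sink (j , refl))
      j≢k : j ≢ k
      j≢k refl = unused zΔ (subst (j ∈ₗ_) (sym ez) (∈-++⁺ʳ z₁ (here refl)))

    source⇒forkCoherentAt : ∀ {k} → Source (src k) → ForkCoherentAt [] k
    source⇒forkCoherentAt source zΔ ez (inj₁ ([]<z₁ , j<k))
      with refl ← chain-into-source (route-prefix (Δ-route zΔ) ez) (subst Source (sym (out-src j<k)) source) =
      InLex.<ʳ-irrefl [] []<z₁
    source⇒forkCoherentAt source zΔ ez (inj₂ (z₁<[] , _)) = InLex.≮ₗ[] _ z₁<[]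

    ¬leaves⇒forkCoherentAt : ∀ {p k} → ¬ Leaves (src k) → ForkCoherentAt p k
    ¬leaves⇒forkCoherentAt ¬leaves zΔ ez (inj₁ (_ , j<k)) = ¬leaves (_ , zΔ , _ , _ , _ , ez , out-src j<k)
    ¬leaves⇒forkCoherentAt ¬leaves zΔ ez (inj₂ (_ , k<j)) = ¬leaves (_ , zΔ , _ , _ , _ , ez , sym (out-src k<j))

    ¬leaves⇒unused : ∀ {h} → ¬ Sink (tgt h) → ¬ Leaves (tgt h) → Unused h
    ¬leaves⇒unused {h} ¬sink ¬leaves {z} zΔ h∈z
      with ys , rest , ez ← ∈-∃++ h∈z
      with route-suffix (Δ-route zΔ) (through-tgt (Δ-route zΔ) ez)
    ... | _ , [] , sink = ¬sink sink
    ... | _ , s ∷ _ , _ = ¬leaves (z , zΔ , ys ∷ʳ h , _ , _ , proj₁ (through-tgt (Δ-route zΔ) ez) , s)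

    prefix-at-source : ∀ {k} → Source (src k) → CoherentPrefix k
    prefix-at-source source = _ , [] , source , [] , forkCoherent-∷ʳ forkCoherent-[] (source⇒forkCoherentAt source)

    prefix-∷ʳ : ∀ {k h} → tgt h ≡ src k → ¬ Leaves (src k) → CoherentPrefix h → CoherentPrefix k
    prefix-∷ʳ {h = h} eh ¬leaves (a , P , sa , cP , fc) =
      a , P ∷ʳ h , sa , subst (Chain a (P ∷ʳ h)) eh (chain-++ cP (refl ∷ [])) ,
      forkCoherent-∷ʳ fc (¬leaves⇒forkCoherentAt {P ∷ʳ h} ¬leaves)

    -- Walk back from k: stop at a source, copy a route of Δ as soon as one leaves the current vertex,
    -- and otherwise step back along any incoming edge.
    ¬¬coherentPrefix : ∀ k → Acc _<ᶠ_ (src k) → Unused k → ¬ ¬ CoherentPrefix k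
    ¬¬coherentPrefix k (acc rec) unused = do
      no ¬source ← ¬¬-excluded-middle {A = Source (src k)}
        where yes source → pure (prefix-at-source source)
      no ¬leaves ← ¬¬-excluded-middle {A = Leaves (src k)}
        where yes leaves → prefix-leaving ¬source unused leaves
      h , eh ← ¬source
      prefix-h ← ¬¬coherentPrefix h (rec (subst (src h <ᶠ_) eh (src<tgt h)))
        (¬leaves⇒unused (λ sink → sink (k , sym eh)) (subst (λ v → ¬ Leaves v) (sym eh) ¬leaves))
      pure (prefix-∷ʳ eh ¬leaves prefix-h)

    EntersBelow EntersAbove : Edge → List Edge → Set
    EntersBelow k s = ∃ λ z → z ∈ Δ × ∃₂ λ z₁ j → proj₂ z ≡ z₁ ++ j ∷ s × j <in k
    EntersAbove k s = ∃ λ z → z ∈ Δ × ∃₂ λ z₁ j → proj₂ z ≡ z₁ ++ j ∷ s × k <in j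

    CoherentSuffix : Edge → Set
    CoherentSuffix k = ∃₂ λ b S → Sink b × Chain (tgt k) S b × JoinCoherent (k ∷ S)

    suffix-from-route : ∀ {k zs rest j S} → zs ∈ Δ → proj₂ zs ≡ rest ++ j ∷ S → tgt j ≡ tgt k →
      JoinCoherentAt k S → CoherentSuffix k
    suffix-from-route {S = S} zsΔ ezs tj jcAt
      with b , cS , sb ← route-suffix (Δ-route zsΔ) (through-tgt (Δ-route zsΔ) ezs) =
      b , S , sb , subst (λ v → Chain v S b) tj cS ,
      joinCoherent-∷ jcAt (Δ-joinCoherent zsΔ (proj₁ (through-tgt (Δ-route zsΔ) ezs)))

    suffix-below : ∀ {k s} → EntersBelow k s → ¬ ¬ CoherentSuffix k
    suffix-below {k} below = do
      S , (_ , zΔ , _ , j , ez , j<k) , S-max ← ¬¬-maximal OutLex.<ₗ-isStrictPartialOrder (EntersBelow k) (lists≤ n) below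
      pure (suffix-from-route zΔ ez (in-tgt j<k) λ where
        z′Δ ez′ (inj₁ (k<j′ , z₂<S)) → Δ-joinCoherentAt zΔ ez z′Δ ez′ (inj₁ (in-trans j<k k<j′ , z₂<S))
        z′Δ ez′ (inj₂ (j′<k , S<z₂)) → S-max (Δ-suffix∈lists≤ z′Δ ez′) (_ , z′Δ , _ , _ , ez′ , j′<k) S<z₂)

    suffix-above : ∀ {k s} → ¬ ∃ (EntersBelow k) → EntersAbove k s → ¬ ¬ CoherentSuffix k
    suffix-above {k} ¬below above = do
      S , (_ , zΔ , _ , j , ez , k<j) , S-min ←
        ¬¬-maximal (Flip.isStrictPartialOrder OutLex.<ₗ-isStrictPartialOrder) (EntersAbove k) (lists≤ n) above
      pure (suffix-from-route zΔ ez (sym (in-tgt k<j)) λ where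
        z′Δ ez′ (inj₁ (k<j′ , z₂<S)) → S-min (Δ-suffix∈lists≤ z′Δ ez′) (_ , z′Δ , _ , _ , ez′ , k<j′) z₂<S
        z′Δ ez′ (inj₂ (j′<k , _))    → ¬below (_ , _ , z′Δ , _ , _ , ez′ , j′<k))

    suffix-entering : ∀ {k} → ¬ Sink (tgt k) → Unused k → Enters (tgt k) → ¬ ¬ CoherentSuffix k
    suffix-entering {k} ¬sink unused (z , zΔ , z₁ , j , z₂ , ez , tj) = do
      no ¬below ← ¬¬-excluded-middle {A = ∃ (EntersBelow k)}
        where yes (_ , below) → suffix-below below
      [ (λ j<k → contradiction (z₂ , z , zΔ , z₁ , j , ez , j<k) ¬below) ,
        (λ k<j → suffix-above ¬below (z , zΔ , z₁ , j , ez , k<j)) ]′ (in-total j k tj internal j≢k)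
      where
      internal : Internal (tgt j)
      internal = (λ source → source (j , refl)) , (λ sink → ¬sink (subst Sink tj sink))
      j≢k : j ≢ k
      j≢k refl = unused zΔ (subst (j ∈ₗ_) (sym ez) (∈-++⁺ʳ z₁ (here refl)))

    sink⇒joinCoherentAt : ∀ {k} → Sink (tgt k) → JoinCoherentAt k []
    sink⇒joinCoherentAt sink zΔ ez (inj₁ (_ , z₂<[])) = OutLex.≮ₗ[] _ z₂<[]
    sink⇒joinCoherentAt sink zΔ ez (inj₂ (j<k , []<z₂))
      with _ , cz₂ , _ ← route-suffix (Δ-route zΔ) (through-tgt (Δ-route zΔ) ez)
      with refl ← chain-from-sink cz₂ (subst Sink (sym (in-tgt j<k)) sink) =
      OutLex.<ₗ-irrefl [] []<z₂

    ¬enters⇒joinCoherentAt : ∀ {k s} → ¬ Enters (tgt k) → JoinCoherentAt k s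
    ¬enters⇒joinCoherentAt ¬enters zΔ ez (inj₁ (k<j , _)) = ¬enters (_ , zΔ , _ , _ , _ , ez , sym (in-tgt k<j))
    ¬enters⇒joinCoherentAt ¬enters zΔ ez (inj₂ (j<k , _)) = ¬enters (_ , zΔ , _ , _ , _ , ez , in-tgt j<k)

    ¬enters⇒unused : ∀ {h} → ¬ Source (src h) → ¬ Enters (src h) → Unused h
    ¬enters⇒unused {h} ¬source ¬enters {z} zΔ h∈z
      with ys , rest , ez ← ∈-∃++ h∈z
      with chain-∷ʳ-view (route-prefix (Δ-route zΔ) ez)
    ... | inj₁ (refl , start≡) = ¬source (subst Source start≡ (proj₁ (Δ-route zΔ)))
    ... | inj₂ (ys′ , j , refl , tj) =
      ¬enters (z , zΔ , ys′ , j , h ∷ rest , trans ez (++-assoc ys′ (j ∷ []) (h ∷ rest)) , tj)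

    suffix-at-sink : ∀ {k} → Sink (tgt k) → CoherentSuffix k
    suffix-at-sink sink = _ , [] , sink , [] , joinCoherent-∷ (sink⇒joinCoherentAt sink) joinCoherent-[]

    suffix-∷ : ∀ {k h} → src h ≡ tgt k → ¬ Enters (tgt k) → CoherentSuffix h → CoherentSuffix k
    suffix-∷ {h = h} eh ¬enters (b , S , sb , cS , jc) =
      b , h ∷ S , sb , eh ∷ cS , joinCoherent-∷ (¬enters⇒joinCoherentAt {s = h ∷ S} ¬enters) jc

    ¬¬coherentSuffix : ∀ k → Acc _>ᶠ_ (tgt k) → Unused k → ¬ ¬ CoherentSuffix k
    ¬¬coherentSuffix k (acc rec) unused = do
      no ¬sink ← ¬¬-excluded-middle {A = Sink (tgt k)}
        where yes sink → pure (suffix-at-sink sink)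
      no ¬enters ← ¬¬-excluded-middle {A = Enters (tgt k)}
        where yes enters → suffix-entering ¬sink unused enters
      h , eh ← ¬sink
      suffix-h ← ¬¬coherentSuffix h (rec (subst (_<ᶠ tgt h) eh (src<tgt h)))
        (¬enters⇒unused (λ source → source (k , sym eh)) (subst (λ v → ¬ Enters v) (sym eh) ¬enters))
      pure (suffix-∷ eh ¬enters suffix-h)

  ¬clockwise-self : ∀ {t v} → ¬ Clockwise t t v
  ¬clockwise-self (_ , p₁ , _ , q₁ , _ , (ep , cp) , (eq , cq) , p₁<q₁ , _)
    with refl ← chain-prefix-unique p₁ q₁ cp cq (trans (sym ep) eq) = InLex.<ʳ-irrefl p₁ p₁<q₁

  maximalClique-closed : ∀ {Δ t} → MaximalClique Δ → IsRoute t → (∀ {z} → z ∈ Δ → Coherent t z) → t ∈ Δ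
  maximalClique-closed {Δ} {t} ((Δ-routes , Δ-coherent) , maximal) t-route t-coherent =
    maximal Θ (Θ-routes , Θ-coherent) inj₁ (inj₂ refl)
    where
    Θ : Pred Walk 0ℓ
    Θ z = z ∈ Δ ⊎ z ≡ t
    Θ-routes : ∀ {z} → z ∈ Θ → IsRoute z
    Θ-routes (inj₁ zΔ)   = Δ-routes zΔ
    Θ-routes (inj₂ refl) = t-route
    Θ-coherent : ∀ {z z′} → z ∈ Θ → z′ ∈ Θ → Coherent z z′
    Θ-coherent (inj₁ zΔ)   (inj₁ z′Δ)  = Δ-coherent zΔ z′Δ
    Θ-coherent (inj₁ zΔ)   (inj₂ refl) v = Product.swap (t-coherent zΔ v)
    Θ-coherent (inj₂ refl) (inj₁ z′Δ)  = t-coherent z′Δ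
    Θ-coherent (inj₂ refl) (inj₂ refl) v = ¬clockwise-self , ¬clockwise-self

  maximalClique-uses : ∀ {Δ} (Δ-maximal : MaximalClique Δ) k → ¬ Clique.Unused Δ (proj₁ Δ-maximal) k
  maximalClique-uses {Δ} Δ-maximal k unused = ¬¬⊥⇒⊥ do
    a , P , sa , cP , fc ← ¬¬coherentPrefix k (<-wellFounded (src k)) unused
    b , S , sb , cS , jc ← ¬¬coherentSuffix k (>-wellFounded (tgt k)) unused
    let cT = chain-++ cP (refl ∷ cS)
        T∈Δ = maximalClique-closed Δ-maximal (sa , b , cT , sb) (spliced-coherent sa cT sb unused fc jc)
    pure (unused T∈Δ (∈-++⁺ʳ P (here refl)))
    where
    open Clique Δ (proj₁ Δ-maximal)

  -- Subroutes of conflict and their corners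

  lastV-chain : ∀ {a xs b} → Chain a xs b → lastV a xs ≡ b
  lastV-chain []      = refl
  lastV-chain (_ ∷ p) = lastV-chain p

  chain-∷ʳ-tgt : ∀ xs {a x b} → Chain a (xs ∷ʳ x) b → tgt x ≡ b
  chain-∷ʳ-tgt xs p with _ , _ , _ ∷ [] ← chain-++⁻ xs p = refl

  chain-enters : ∀ {a x xs b} → Chain a (x ∷ xs) b → Any (λ e → tgt e ≡ b) (x ∷ xs)
  chain-enters (_ ∷ [])     = here refl
  chain-enters (_ ∷ (s ∷ p)) = there (chain-enters (s ∷ p))

  onWalk-split : ∀ {v s₀ sl w} → Chain s₀ sl w → OnWalk v (s₀ , sl) → ∃₂ λ s₁ s₂ → sl ≡ s₁ ++ s₂ × Chain s₀ s₁ v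
  onWalk-split {sl = sl} _ (inj₁ refl)                   = [] , sl , refl , []
  onWalk-split {sl = x ∷ sl} (s ∷ _) (inj₂ (here refl))  = x ∷ [] , sl , refl , s ∷ []
  onWalk-split {sl = x ∷ _} (s ∷ p) (inj₂ (there on-sl))
    with s₁ , s₂ , refl , p₁ ← onWalk-split p (inj₂ on-sl) = x ∷ s₁ , s₂ , refl , s ∷ p₁

  through-unique : ∀ {z v p₁ p₂ q₁ q₂} → Through z v p₁ p₂ → Through z v q₁ q₂ → p₁ ≡ q₁ × p₂ ≡ q₂
  through-unique {p₁ = p₁} {q₁ = q₁} (ep , cp) (eq , cq)
    with refl ← chain-prefix-unique p₁ q₁ cp cq (trans (sym ep) eq) = refl , ++-cancelˡ p₁ _ _ (trans (sym ep) eq)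

  subpath-through : ∀ {z z₁ s z₂ s₁ s₂ v} → Splits z z₁ s z₂ → proj₂ s ≡ s₁ ++ s₂ → Chain (proj₁ s) s₁ v →
    Through z v (z₁ ++ s₁) (s₂ ++ z₂)
  subpath-through {z₁ = z₁} {z₂ = z₂} {s₁} {s₂} (ez , cz) es cs₁ =
    trans ez (trans (cong (λ l → z₁ ++ (l ++ z₂)) es)
      (trans (cong (z₁ ++_) (++-assoc s₁ s₂ z₂)) (sym (++-assoc z₁ s₁ (s₂ ++ z₂))))) ,
    chain-++ cz cs₁

  subpath-chain : ∀ {z z₁ s z₂} → IsRoute z → Splits z z₁ s z₂ → Chain (proj₁ s) (proj₂ s) (lastV (proj₁ s) (proj₂ s))
  subpath-chain {s = s₀ , sl} rz sp with _ , cs , _ ← route-suffix rz sp with _ , cs₁ , _ ← chain-++⁻ sl cs =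
    subst (Chain s₀ sl) (sym (lastV-chain cs₁)) cs₁


  clockwise-across : ∀ {r r′ v s r₁ r₂ r′₁ r′₂} → IsRoute r → Clockwise r r′ v → OnWalk v s →
    Splits r r₁ s r₂ → Splits r′ r′₁ s r′₂ → InLt r₁ r′₁ × OutLt r′₂ r₂
  clockwise-across {r₁ = r₁} {r′₁ = r′₁} rr (_ , _ , _ , _ , _ , thr , thr′ , p₁<q₁ , q₂<p₂) on-s sp sp′
    with s₁ , s₂ , es , cs₁ ← onWalk-split (subpath-chain rr sp) on-s
    with refl , refl ← through-unique thr (subpath-through sp es cs₁)
    with refl , refl ← through-unique thr′ (subpath-through sp′ es cs₁) =
    InLex.<ʳ-++⁻ s₁ {r₁} {r′₁} p₁<q₁ , OutLex.<ₗ-++⁻ s₂ q₂<p₂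

  maxCommon-entry : ∀ {p q v s p₂ q₂} A B C → MaxCommon p q v s →
    Splits p (A ++ C) s p₂ → Splits q (B ++ C) s q₂ → C ≡ []
  maxCommon-entry _ _ [] _ _ _ = refl
  maxCommon-entry {p} {q} {v} {s₀ , sl} {p₂} {q₂} A B (c ∷ C) ((_ , _ , on-s) , maximal) (ep , cp) (eq , cq)
    with y , cA , cC ← chain-++⁻ A cp
    with y′ , cB , cC′ ← chain-++⁻ B cq
    with refl ← chain-start-unique cC′ cC =
    contradiction (++-identityˡ-unique (c ∷ C) (sym (cong proj₂ (maximal t (t⊆p , t⊆q , on-t on-s) s⊆t)))) λ ()
    where
    t : Walk
    t = y , (c ∷ C) ++ sl
    regroup : ∀ {ys} X R → ys ≡ (X ++ c ∷ C) ++ (sl ++ R) → ys ≡ X ++ (proj₂ t ++ R)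
    regroup X R e = trans e (trans (++-assoc X (c ∷ C) (sl ++ R)) (cong (X ++_) (sym (++-assoc (c ∷ C) sl R))))
    t⊆p : SubpathOf t p
    t⊆p = A , p₂ , regroup A p₂ ep , cA
    t⊆q : SubpathOf t q
    t⊆q = B , q₂ , regroup B q₂ eq , cB
    s⊆t : SubpathOf (s₀ , sl) t
    s⊆t = c ∷ C , [] , cong ((c ∷ C) ++_) (sym (++-identityʳ sl)) , cC
    on-t : OnWalk v (s₀ , sl) → OnWalk v t
    on-t (inj₁ v≡s₀)  = inj₂ (++⁺ˡ (subst (λ u → Any (λ e → tgt e ≡ u) (c ∷ C)) (sym v≡s₀) (chain-enters cC)))
    on-t (inj₂ on-sl) = inj₂ (++⁺ʳ (c ∷ C) on-sl)

  maxCommon-exit : ∀ {p q v s p₁ q₁} C {p₂ q₂} → MaxCommon p q v s →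
    Splits p p₁ s (C ++ p₂) → Splits q q₁ s (C ++ q₂) → C ≡ []
  maxCommon-exit [] _ _ _ = refl
  maxCommon-exit {p} {q} {v} {s₀ , sl} {p₁} {q₁} (c ∷ C) {p₂} {q₂} ((_ , _ , on-s) , maximal) (ep , cp) (eq , cq) =
    contradiction (++-identityʳ-unique sl (sym (cong proj₂ (maximal t (t⊆p , t⊆q , on-t on-s) s⊆t)))) λ ()
    where
    t : Walk
    t = s₀ , sl ++ c ∷ C
    t⊆p : SubpathOf t p
    t⊆p = p₁ , p₂ , trans ep (cong (p₁ ++_) (sym (++-assoc sl (c ∷ C) p₂))) , cp
    t⊆q : SubpathOf t q
    t⊆q = q₁ , q₂ , trans eq (cong (q₁ ++_) (sym (++-assoc sl (c ∷ C) q₂))) , cq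
    s⊆t : SubpathOf (s₀ , sl) t
    s⊆t = [] , c ∷ C , refl , []
    on-t : OnWalk v (s₀ , sl) → OnWalk v t
    on-t (inj₁ v≡s₀)  = inj₁ v≡s₀
    on-t (inj₂ on-sl) = inj₂ (++⁺ˡ on-sl)

  subpath-suffix : ∀ {z z₁ s z₂} → IsRoute z → Splits z z₁ s z₂ →
    ∃ λ w → Chain (lastV (proj₁ s) (proj₂ s)) z₂ w × Sink w
  subpath-suffix {z₁ = z₁} {s₀ , sl} {z₂} rz sp =
    route-suffix rz (subpath-through {z₁ = z₁} {z₂ = z₂} {sl} {[]} sp (sym (++-identityʳ sl)) (subpath-chain rz sp))

  subpath-exit : ∀ {z z₁ s x z₂} → IsRoute z → Splits z z₁ s (x ∷ z₂) → src x ≡ lastV (proj₁ s) (proj₂ s)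
  subpath-exit {z₁ = z₁} {s} {x} {z₂} rz sp
    with _ , x-src ∷ _ , _ ← subpath-suffix {z₁ = z₁} {s} {x ∷ z₂} rz sp = x-src

  conflict-shape : ∀ {r r′ v s r₁ r₂ r′₁ r′₂} → IsRoute r → IsRoute r′ → Clockwise r r′ v → MaxCommon r r′ v s →
    Splits r r₁ s r₂ → Splits r′ r′₁ s r′₂ →
    (∃₂ λ A e → ∃₂ λ A′ e′ → r₁ ≡ A ∷ʳ e × r′₁ ≡ A′ ∷ʳ e′ × e <in e′) ×
    (∃₂ λ f B → ∃₂ λ f′ B′ → r₂ ≡ f ∷ B × r′₂ ≡ f′ ∷ B′ × f′ <out f)
  conflict-shape {r} {r′} {s = s} {r₁} {r₂} {r′₁} {r′₂} rr rr′ cw common sp sp′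
    with r₁<r′₁ , r′₂<r₂ ← clockwise-across rr cw (proj₂ (proj₂ (proj₁ common))) sp sp′
    with C , e , e′ , A , A′ , refl , refl , e<e′ ← inLt-cobranch (proj₂ sp) (proj₁ rr) (proj₂ sp′) (proj₁ rr′) r₁<r′₁
    with refl ← maxCommon-entry (A ∷ʳ e) (A′ ∷ʳ e′) C common
                  (subst (λ l → Splits r l s r₂) (sym (++-assoc A (e ∷ []) C)) sp)
                  (subst (λ l → Splits r′ l s r′₂) (sym (++-assoc A′ (e′ ∷ []) C)) sp′)
    with _ , cr₂ , sk ← subpath-suffix rr sp
    with _ , cr′₂ , sk′ ← subpath-suffix rr′ sp′
    with C′ , f′ , f , B′ , B , refl , refl , f′<f ← outLt-branch cr′₂ sk′ cr₂ sk r′₂<r₂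
    with refl ← maxCommon-exit C′ common sp sp′ =
    (A , e , A′ , e′ , refl , refl , e<e′) , (f , B , f′ , B′ , refl , refl , f′<f)

  entering-unique : ∀ {z a x b c y d} → IsRoute z → proj₂ z ≡ a ++ x ∷ b → proj₂ z ≡ c ++ y ∷ d → tgt x ≡ tgt y → x ≡ y
  entering-unique {a = a} {x} {c = c} {y} {d} rz ez ez′ tx≡ty =
    ∷ʳ-injectiveʳ a c (proj₁ (through-unique (through-tgt rz ez)
      (subst (λ v → Through _ v (c ∷ʳ y) d) (sym tx≡ty) (through-tgt rz ez′))))

  leaving-unique : ∀ {z a x b c y d} → IsRoute z → proj₂ z ≡ a ++ x ∷ b → proj₂ z ≡ c ++ y ∷ d → src x ≡ src y → x ≡ y
  leaving-unique {c = c} {y} {d} rz ez ez′ sx≡sy =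
    ∷-injectiveˡ (proj₂ (through-unique (through-src rz ez)
      (subst (λ v → Through _ v c (y ∷ d)) (sym sx≡sy) (through-src rz ez′))))

  onlyDiff-≡ : ∀ {Δ Δ′ r} → (∃ λ r₀ → OnlyDiff Δ Δ′ r₀) → r ∈ Δ → r ∉ Δ′ → ∀ {z} → z ∈ Δ → z ∉ Δ′ → z ≡ r
  onlyDiff-≡ (_ , _ , _ , unique) r∈Δ r∉Δ′ zΔ z∉Δ′ = trans (unique zΔ z∉Δ′) (sym (unique r∈Δ r∉Δ′))

  maxCommon-sym : ∀ {p q v s} → MaxCommon p q v s → MaxCommon q p v s
  maxCommon-sym ((s⊆p , s⊆q , on-s) , maximal) =
    (s⊆q , s⊆p , on-s) , λ t (t⊆q , t⊆p , on-t) → maximal t (t⊆p , t⊆q , on-t)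

  module _ {Δ Δ′ r r′} (Δ-maximal : MaximalClique Δ) (Δ′-clique : IsClique Δ′) (r∈Δ : r ∈ Δ) (r′∈Δ′ : r′ ∈ Δ′)
    (Δ∖Δ′⊆r : ∀ {z} → z ∈ Δ → z ∉ Δ′ → z ≡ r) where

    open Clique Δ (proj₁ Δ-maximal)
    private module Δ′ = Clique Δ′ Δ′-clique

    ¬¬∈Δ′⊎≡r : ∀ {z} → z ∈ Δ → ¬ ¬ (z ∈ Δ′ ⊎ z ≡ r)
    ¬¬∈Δ′⊎≡r zΔ = do
      no z∉Δ′ ← ¬¬-excluded-middle
        where yes z∈Δ′ → pure (inj₁ z∈Δ′)
      pure (inj₂ (Δ∖Δ′⊆r zΔ z∉Δ′))

    incoming-consecutive : ∀ {A e R A′ e′ R′} → proj₂ r ≡ A ++ e ∷ R → proj₂ r′ ≡ A′ ++ e′ ∷ R′ → OutLt R′ R →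
      ¬ ∃ λ g → e <in g × g <in e′
    incoming-consecutive {A} {e} {R} {A′} {e′} {R′} er er′ R′<R (g , e<g , g<e′) = maximalClique-uses Δ-maximal g unused
      where
      unused : Unused g
      unused {z} zΔ g∈z with ys , rest , ez ← ∈-∃++ g∈z = ¬¬⊥⇒⊥ do
        inj₁ z∈Δ′ ← ¬¬∈Δ′⊎≡r zΔ
          where inj₂ refl →
                  pure (in-irrefl g (subst (_<in g) (entering-unique (Δ-route r∈Δ) er ez (in-tgt e<g)) e<g))
        let _ , cR , _    = route-suffix (Δ-route r∈Δ) (through-tgt (Δ-route r∈Δ) er)
            w , crest , _ = route-suffix (Δ-route zΔ) (through-tgt (Δ-route zΔ) ez)
            w′ , cR′ , _  = route-suffix (Δ′.Δ-route r′∈Δ′) (through-tgt (Δ′.Δ-route r′∈Δ′) er′)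
            crest′ = subst (λ v → Chain v rest w) (sym (in-tgt e<g)) crest
            cR″    = subst (λ v → Chain v R′ w′) (sym (in-tgt (in-trans e<g g<e′))) cR′
        R≤rest ← OutLex.≮⇒¬¬≥ (outLeq-total (e , refl) crest′ cR) λ rest<R →
          Δ-¬clockwise r∈Δ zΔ (clockwiseAtJoin⇒clockwise (Δ-route r∈Δ) (Δ-route zΔ) er ez (e<g , rest<R))
        rest≤R′ ← OutLex.≮⇒¬¬≥ (outLeq-total (e , refl) cR″ crest′) λ R′<rest →
          Δ′.Δ-¬clockwise z∈Δ′ r′∈Δ′
            (clockwiseAtJoin⇒clockwise (Δ-route zΔ) (Δ′.Δ-route r′∈Δ′) ez er′ (g<e′ , R′<rest))
        pure (proj₂ R′<R (OutLex.≤ₗ-trans R≤rest rest≤R′))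

    outgoing-consecutive : ∀ {P f B P′ f′ B′} → proj₂ r ≡ P ++ f ∷ B → proj₂ r′ ≡ P′ ++ f′ ∷ B′ → InLt P P′ →
      ¬ ∃ λ g → f′ <out g × g <out f
    outgoing-consecutive {P} {f} {B} {P′} {f′} {B′} er er′ P<P′ (g , f′<g , g<f) = maximalClique-uses Δ-maximal g unused
      where
      unused : Unused g
      unused {z} zΔ g∈z with ys , rest , ez ← ∈-∃++ g∈z = ¬¬⊥⇒⊥ do
        inj₁ z∈Δ′ ← ¬¬∈Δ′⊎≡r zΔ
          where inj₂ refl →
                  pure (out-irrefl g (subst (g <out_) (leaving-unique (Δ-route r∈Δ) er ez (sym (out-src g<f))) g<f))
        let cP   = route-prefix (Δ-route r∈Δ) er
            cys  = subst (Chain _ ys) (out-src g<f) (route-prefix (Δ-route zΔ) ez)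
            cP′  = subst (Chain _ P′) (out-src (out-trans f′<g g<f)) (route-prefix (Δ′.Δ-route r′∈Δ′) er′)
        ys≤P ← InLex.≮⇒¬¬≥ {reverse P} {reverse ys} (inLeq-total (f , refl) cP cys) λ P<ys →
          Δ-¬clockwise r∈Δ zΔ (clockwiseAtFork⇒clockwise (Δ-route r∈Δ) (Δ-route zΔ) er ez (P<ys , g<f))
        P′≤ys ← InLex.≮⇒¬¬≥ {reverse ys} {reverse P′} (inLeq-total (f , refl) cys cP′) λ ys<P′ →
          Δ′.Δ-¬clockwise z∈Δ′ r′∈Δ′
            (clockwiseAtFork⇒clockwise (Δ-route zΔ) (Δ′.Δ-route r′∈Δ′) ez er′ (ys<P′ , f′<g))
        pure (proj₂ P<P′ (InLex.≤ₗ-trans P′≤ys ys≤P))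

    corners : ∀ {v s r₁ r₂ r′₁ r′₂} → Clockwise r r′ v → MaxCommon r r′ v s →
      Splits r r₁ s r₂ → Splits r′ r′₁ s r′₂ →
      (∃[ a ] ∃[ e ] ∃[ a′ ] ∃[ e′ ] (r₁ ≡ a ∷ʳ e × r′₁ ≡ a′ ∷ʳ e′ × IsLeftCorner (proj₁ s) e e′)) ×
      (∃[ f ] ∃[ b ] ∃[ f′ ] ∃[ b′ ] (r₂ ≡ f ∷ b × r′₂ ≡ f′ ∷ b′ × IsRightCorner (lastV (proj₁ s) (proj₂ s)) f′ f))
    corners {s = s₀ , sl} {r₂ = r₂} {r′₂ = r′₂} cw common sp@(er , cr) sp′@(er′ , cr′)
      with (A , e , A′ , e′ , refl , refl , e<e′) , (f , B , f′ , B′ , refl , refl , f′<f)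
             ← conflict-shape (Δ-route r∈Δ) (Δ′.Δ-route r′∈Δ′) cw common sp sp′ =
      (A , e , A′ , e′ , refl , refl , left-corner) , (f , B , f′ , B′ , refl , refl , right-corner)
      where
      e-tgt : tgt e ≡ s₀
      e-tgt = chain-∷ʳ-tgt A cr
      f-src : src f ≡ lastV s₀ sl
      f-src = subpath-exit (Δ-route r∈Δ) sp
      f′-src : src f′ ≡ lastV s₀ sl
      f′-src = subpath-exit (Δ′.Δ-route r′∈Δ′) sp′

      left-corner : IsLeftCorner s₀ e e′
      left-corner =
        subst Internal e-tgt (in-internal e<e′) , e-tgt , chain-∷ʳ-tgt A′ cr′ , e<e′ ,
        λ (g , _ , e<g , g<e′) →
          incoming-consecutive
            (trans er (++-assoc A (e ∷ []) (sl ++ r₂))) (trans er′ (++-assoc A′ (e′ ∷ []) (sl ++ r′₂)))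
            (OutLex.<ₗ-++⁺ sl (OutLex.<ₗ-branch [] f′<f)) (g , e<g , g<e′)

      right-corner : IsRightCorner (lastV s₀ sl) f′ f
      right-corner =
        subst Internal f′-src (out-internal f′<f) , f′-src , f-src , f′<f ,
        λ (g , _ , f′<g , g<f) →
          outgoing-consecutive
            (trans er (sym (++-assoc (A ∷ʳ e) sl (f ∷ B)))) (trans er′ (sym (++-assoc (A′ ∷ʳ e′) sl (f′ ∷ B′))))
            (InLex.<ʳ-++⁺ sl {A ∷ʳ e} {A′ ∷ʳ e′} (InLex.<ʳ-branch A A′ [] e<e′)) (g , f′<g , g<f)

lemma3p1 : (G : FlowGraph) (F : Framing G) →
    let open Framed G F in
    (Δ Δ' : Pred Walk 0ℓ) → MaximalClique Δ → MaximalClique Δ' → Adjacent Δ Δ' →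
    (r r' : Walk) → r ∈ Δ → r ∉ Δ' → r' ∈ Δ' → r' ∉ Δ →
    (s : Walk) → SubrouteOfConflict r r' s →
    (r₁ r₂ r'₁ r'₂ : List Edge) → Splits r r₁ s r₂ → Splits r' r'₁ s r'₂ →
    (∃[ a ] ∃[ e ] ∃[ a' ] ∃[ e' ]
      (r₁ ≡ a ∷ʳ e × r'₁ ≡ a' ∷ʳ e' ×
        (IsLeftCorner (proj₁ s) e e' ⊎ IsLeftCorner (proj₁ s) e' e)))
    ×
    (∃[ f ] ∃[ b ] ∃[ f' ] ∃[ b' ]
      (r₂ ≡ f ∷ b × r'₂ ≡ f' ∷ b' ×
        (IsRightCorner (lastV (proj₁ s) (proj₂ s)) f f' ⊎
         IsRightCorner (lastV (proj₁ s) (proj₂ s)) f' f)))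
lemma3p1 G F _ _ Δ-maximal Δ′-maximal (Δ∖Δ′ , _) _ _ r∈Δ r∉Δ′ r′∈Δ′ _ _ (_ , inj₁ r↻r′ , common) _ _ _ _ sp sp′
  with (a , e , a′ , e′ , er₁ , er′₁ , left) , (f , b , f′ , b′ , er₂ , er′₂ , right)
         ← corners G F Δ-maximal (proj₁ Δ′-maximal) r∈Δ r′∈Δ′ (onlyDiff-≡ G F Δ∖Δ′ r∈Δ r∉Δ′) r↻r′ common sp sp′ =
  (a , e , a′ , e′ , er₁ , er′₁ , inj₁ left) , (f , b , f′ , b′ , er₂ , er′₂ , inj₂ right)
lemma3p1 G F _ _ Δ-maximal Δ′-maximal (_ , Δ′∖Δ) _ _ r∈Δ _ r′∈Δ′ r′∉Δ _ (_ , inj₂ r′↻r , common) _ _ _ _ sp sp′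
  with (a′ , e′ , a , e , er′₁ , er₁ , left) , (f′ , b′ , f , b , er′₂ , er₂ , right)
         ← corners G F Δ′-maximal (proj₁ Δ-maximal) r′∈Δ′ r∈Δ (onlyDiff-≡ G F Δ′∖Δ r′∈Δ′ r′∉Δ) r′↻r
             (maxCommon-sym G F common) sp′ sp =
  (a , e , a′ , e′ , er₁ , er′₁ , inj₂ left) , (f , b , f′ , b′ , er₂ , er′₂ , inj₁ right)
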